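{- Let $\Gamma$ be a typing environment, $\nabla$ a partial function from table identifiers to product types, $\widetilde{\mathit{TB}}=\mathit{TB}_1,\dots,\mathit{TB}_n$ a list of tables with $\Gamma,\nabla\vdash\mathit{TB}_j\triangleright\tau_j$ for $j=1,\dots,n$, and $\langle l_i::(I_i,R_i)\rangle_i$ a list of localized tables such that $\Gamma,\nabla\vdash_C(I_k,R_k)$ holds for each $(I_k,R_k)$ in the list. Then, whenever $\otimes_{\mathrm{R}}(\widetilde{\mathit{TB}},\langle l_i::(I_i,R_i)\rangle_i)$ is defined, every $t'\in\otimes_{\mathrm{R}}(\widetilde{\mathit{TB}},\langle l_i::(I_i,R_i)\rangle_i)$ satisfies $[]\vdash t'\triangleright\mathit{flatten}_{\mathrm{s}}(\tau_1\times\dots\times\tau_n)$.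
   Context: Types: $\tau_d::=\mathit{Int}\mid\mathit{String}\mid\mathit{Loc}\mid\mathit{Id}$; $\tau_m::=\{\tau_d\}\mid\tau_d$; product types $\tau_m^1\times\dots\times\tau_m^n$. An interface is $I=(\mathit{tid},\mathit{sk})$ with identifier $I.\mathit{tid}$ a table identifier or the special symbol $\bot$ and schema $I.\mathit{sk}$ a product type; a data set $R$ is a finite multiset of tuples whose components are constant values (integers, strings, table identifiers, localities, multisets thereof). Tables: $\mathit{TB}::=\mathit{tid}@\ell\mid\mathit{tbv}\mid(I,R)$, where $\ell$ is a locality $l$ or a locality variable $u$ and $\mathit{tbv}$ a table variable. A localized table $l::(I,R)$ pairs a locality with a table. Typing: a typing environment $\Gamma$ is a finite sequence of bindings of variables to types (table variables to product types), at most one per variable; $[]$ is the empty environment. Expression/tuple typing: $\Gamma\vdash u\triangleright\mathit{Loc}$ if $\Gamma(u)=\mathit{Loc}$, $\Gamma\vdash l\triangleright\mathit{Loc}$, $\mathit{num}\triangleright\mathit{Int}$, $\mathit{str}\triangleright\mathit{String}$, $\mathit{tid}\triangleright\mathit{Id}$, a multiset of elements of type $\tau_d$ has type $\{\tau_d\}$, a tuple $e_1,\dots,e_n$ has type $\tau_1\times\dots\times\tau_n$ if each $e_i$ has type $\tau_i$. Table typing: $\Gamma,\nabla\vdash\mathit{tid}@\ell\triangleright\nabla(\mathit{tid})$ if $\mathit{tid}\in\mathrm{dom}(\nabla)$ and $\Gamma\vdash\ell\triangleright\mathit{Loc}$; $\Gamma,\nabla\vdash\mathit{tbv}\triangleright\Gamma(\mathit{tbv})$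 if $\mathit{tbv}\in\mathrm{dom}(\Gamma)$; $\Gamma,\nabla\vdash(I,R)\triangleright I.\mathit{sk}$ if $\Gamma\vdash t\triangleright I.\mathit{sk}$ for all $t\in R$ and ($I.\mathit{tid}\neq\bot\Rightarrow\nabla(I.\mathit{tid})=I.\mathit{sk}$). Component typing: $\Gamma,\nabla\vdash_C(I,R)$ holds iff $\Gamma\vdash t\triangleright I.\mathit{sk}$ for all $t\in R$ and $\nabla(I.\mathit{tid})=I.\mathit{sk}$. $\mathit{flatten}_{\mathrm{s}}((\tau^{11}\times\dots\times\tau^{1n_1})\times\dots\times(\tau^{k1}\times\dots\times\tau^{kn_k}))=\tau^{11}\times\dots\times\tau^{1n_1}\times\dots\times\tau^{k1}\times\dots\times\tau^{kn_k}$; $\mathit{flatten}_{\mathrm{d}}(R)=\{(v_{11},\dots,v_{1n_1},\dots,v_{k1},\dots,v_{kn_k})\mid((v_{11},\dots,v_{1n_1}),\dots,(v_{k1},\dots,v_{kn_k}))\in R\}$. $\otimes_{\mathrm{R}}(\widetilde{\mathit{TB}},\langle l_i::(I_i,R_i)\rangle_i)$ is undefined if either some $\mathit{TB}_j=\mathit{tid}@l$ with no $i$ satisfying $l_i=l$ and $I_i.\mathit{tid}=\mathit{tid}$, or $\widetilde{\mathit{TB}}$ contains some table variable or some $\mathit{tid}@u$ with $u$ a locality variable; otherwise it equals $\mathit{flatten}_{\mathrm{d}}(R'_1\times\dots\times R'_n)$ (Cartesian product of multisets) where $R'_j=R_k$ if $\mathit{TB}_j=I_k.\mathit{tid}@l_k$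 for some $k$, and $R'_j=R_0$ if $\mathit{TB}_j=(I_0,R_0)$. -}

module Defs where

open import Data.Nat using (ℕ)
open import Data.Integer using (ℤ)
open import Data.String using (String)
open import Data.Maybe using (Maybe; just; nothing)
open import Data.List using (List; []; _∷_; map; concat; concatMap)
open import Data.List.Membership.Propositional using (_∈_)
open import Data.List.Relation.Unary.All using (All)
open import Data.List.Relation.Unary.Any using (Any)
open import Data.List.Relation.Unary.AllPairs using (AllPairs)
open import Data.List.Relation.Binary.Pointwise using (Pointwise)
open import Data.Product using (_×_; _,_; proj₁; ∃)
open import Relation.Binary.PropositionalEquality using (_≡_; _≢_)

TId : Set
TId = ℕ

Locality : Set
Locality = ℕ

Var : Set
Var = ℕ

data DTy : Set where
  Int Str LocT IdT : DTy

data MTy : Set where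
  set  : DTy → MTy
  base : DTy → MTy

ProdTy : Set
ProdTy = List MTy

data Ty : Set where
  dty  : DTy → Ty
  prod : ProdTy → Ty

data BaseVal : Set where
  num : ℤ → BaseVal
  str : String → BaseVal
  tid : TId → BaseVal
  loc : Locality → BaseVal

data Val : Set where
  bv   : BaseVal → Val
  mset : List BaseVal → Val

Tuple : Set
Tuple = List Val

-- a data set: finite multiset of tuples (a list, up to order)
DataSet : Set
DataSet = List Tuple

-- interface I = (tid or ⊥, sk); ⊥ is nothing
record Interface : Set where
  constructor iface
  field
    itid : Maybe TId
    sk   : ProdTy
open Interface public

data Loc : Set where
  lit : Locality → Loc
  lvar : Var → Loc

data Table : Set where
  _at_ : TId → Loc → Table
  tbv  : Var → Table
  tab  : Interface → DataSet → Table

LocTable : Set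
LocTable = Locality × Interface × DataSet

Env : Set
Env = List (Var × Ty)

WfEnv : Env → Set
WfEnv Γ = AllPairs (λ b b′ → proj₁ b ≢ proj₁ b′) Γ

_⟨_⟩≡_ : Env → Var → Ty → Set
Γ ⟨ x ⟩≡ τ = (x , τ) ∈ Γ

TEnv : Set
TEnv = TId → Maybe ProdTy

data _⊢b_▷_ (Γ : Env) : BaseVal → DTy → Set where
  t-num : ∀ {n} → Γ ⊢b num n ▷ Int
  t-str : ∀ {s} → Γ ⊢b str s ▷ Str
  t-tid : ∀ {i} → Γ ⊢b tid i ▷ IdT
  t-loc : ∀ {l} → Γ ⊢b loc l ▷ LocT

data _⊢v_▷_ (Γ : Env) : Val → MTy → Set where
  t-base : ∀ {v τ} → Γ ⊢b v ▷ τ → Γ ⊢v bv v ▷ base τ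
  t-set  : ∀ {vs τ} → All (λ v → Γ ⊢b v ▷ τ) vs → Γ ⊢v mset vs ▷ set τ

_⊢t_▷_ : Env → Tuple → ProdTy → Set
Γ ⊢t t ▷ sk = Pointwise (λ e τ → Γ ⊢v e ▷ τ) t sk

data _⊢ℓ_▷Loc (Γ : Env) : Loc → Set where
  t-lit  : ∀ {l} → Γ ⊢ℓ lit l ▷Loc
  t-lvar : ∀ {u} → Γ ⟨ u ⟩≡ dty LocT → Γ ⊢ℓ lvar u ▷Loc

data _,_⊢T_▷_ (Γ : Env) (∇ : TEnv) : Table → ProdTy → Set where
  t-at  : ∀ {i ℓ sk} → ∇ i ≡ just sk → Γ ⊢ℓ ℓ ▷Loc → Γ , ∇ ⊢T (i at ℓ) ▷ sk
  t-tbv : ∀ {x sk} → Γ ⟨ x ⟩≡ prod sk → Γ , ∇ ⊢T tbv x ▷ sk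
  t-tab : ∀ {I R} → All (λ t → Γ ⊢t t ▷ sk I) R
        → (∀ i → itid I ≡ just i → ∇ i ≡ just (sk I))
        → Γ , ∇ ⊢T tab I R ▷ sk I

_,_⊢C_,_ : Env → TEnv → Interface → DataSet → Set
Γ , ∇ ⊢C I , R =
  All (λ t → Γ ⊢t t ▷ sk I) R × ∃ λ i → itid I ≡ just i × ∇ i ≡ just (sk I)

flattenₛ : List ProdTy → ProdTy
flattenₛ = concat

flattenᵈ : List (List Tuple) → DataSet
flattenᵈ = map concat

cartesian : List DataSet → List (List Tuple)
cartesian []       = [] ∷ []
cartesian (R ∷ Rs) = concatMap (λ t → map (t ∷_) (cartesian Rs)) R

-- ⊗_R, as a relation  ⊗R TBs Ls R  meaning "⊗_R(TBs, Ls) is defined and equals R".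
-- The choice of k "for some k" is left open (any matching k is allowed).

data Sel (Ls : List LocTable) : Table → DataSet → Set where
  sel-at  : ∀ {i l I R} → (l , I , R) ∈ Ls → itid I ≡ just i
          → Sel Ls (i at lit l) R
  sel-tab : ∀ {I R} → Sel Ls (tab I R) R

⊗R : List Table → List LocTable → DataSet → Set
⊗R TBs Ls R = ∃ λ R's → Pointwise (Sel Ls) TBs R's × R ≡ flattenᵈ (cartesian R's)

module Submission where

open import Defs
open import Data.List using (List; []; _∷_)
open import Data.List.Membership.Propositional using (_∈_)
open import Data.List.Relation.Unary.All as All using (All; []; _∷_; lookup)
open import Data.List.Relation.Unary.All.Properties using (map⁺; concat⁺)
open import Data.List.Relation.Binary.Pointwise as Pointwise using (Pointwise; []; _∷_)
open import Data.Product using (_,_)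
open import Data.Maybe.Properties using (just-injective)
open import Function using (_∘′_)
open import Relation.Binary.PropositionalEquality using (refl; trans; sym)

-- Each table selected by ⊗_R is well typed at the type of its table expression;
-- the product of well-typed data sets consists of tuples of well-typed tuples,
-- and flattening them concatenates both the tuples and their types. Since all
-- entries are constants, the resulting typings hold in any environment, in
-- particular in the empty one.

⊢b-env-irrelevant : ∀ {Γ Δ v τ} → Γ ⊢b v ▷ τ → Δ ⊢b v ▷ τ
⊢b-env-irrelevant t-num = t-num
⊢b-env-irrelevant t-str = t-str
⊢b-env-irrelevant t-tid = t-tid
⊢b-env-irrelevant t-loc = t-loc

⊢v-env-irrelevant : ∀ {Γ Δ v τ} → Γ ⊢v v ▷ τ → Δ ⊢v v ▷ τ
⊢v-env-irrelevant (t-base v▷τ)  = t-base (⊢b-env-irrelevant v▷τ)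
⊢v-env-irrelevant (t-set vs▷τ) = t-set (All.map ⊢b-env-irrelevant vs▷τ)

⊢t-env-irrelevant : ∀ {Γ Δ t sk} → Γ ⊢t t ▷ sk → Δ ⊢t t ▷ sk
⊢t-env-irrelevant = Pointwise.map ⊢v-env-irrelevant

Sel-typed : ∀ {Γ Δ ∇ Ls TB τ R}
  → All (λ { (l , I , R) → Γ , ∇ ⊢C I , R }) Ls
  → Γ , ∇ ⊢T TB ▷ τ → Sel Ls TB R
  → All (λ t → Δ ⊢t t ▷ τ) R
Sel-typed Ls-typed (t-at ∇i≡τ _) (sel-at I∈Ls itid≡i)
  with lookup Ls-typed I∈Ls
... | R-typed , i′ , itid≡i′ , ∇i′≡sk with trans (sym itid≡i) itid≡i′
... | refl with just-injective (trans (sym ∇i≡τ) ∇i′≡sk)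
... | refl = All.map ⊢t-env-irrelevant R-typed
Sel-typed Ls-typed (t-tab R-typed _) sel-tab = All.map ⊢t-env-irrelevant R-typed

Sels-typed : ∀ {Γ Δ ∇ Ls TBs τs Rs}
  → All (λ { (l , I , R) → Γ , ∇ ⊢C I , R }) Ls
  → Pointwise (λ TB τ → Γ , ∇ ⊢T TB ▷ τ) TBs τs
  → Pointwise (Sel Ls) TBs Rs
  → Pointwise (λ R τ → All (λ t → Δ ⊢t t ▷ τ) R) Rs τs
Sels-typed Ls-typed []              []           = []
Sels-typed Ls-typed (TB▷τ ∷ TBs▷τs) (sel ∷ sels) =
  Sel-typed Ls-typed TB▷τ sel ∷ Sels-typed Ls-typed TBs▷τs sels

All-cartesian : ∀ {B : Set} {P : Tuple → B → Set} {Rs bs}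
  → Pointwise (λ R b → All (λ t → P t b) R) Rs bs
  → All (λ ts → Pointwise P ts bs) (cartesian Rs)
All-cartesian []           = [] ∷ []
All-cartesian (R-ok ∷ Rs-ok) =
  concat⁺ (map⁺ (All.map (λ t-ok → map⁺ (All.map (t-ok ∷_) (All-cartesian Rs-ok))) R-ok))

All-flattenᵈ : ∀ {Γ τs tss}
  → All (λ ts → Pointwise (Γ ⊢t_▷_) ts τs) tss
  → All (λ t → Γ ⊢t t ▷ flattenₛ τs) (flattenᵈ tss)
All-flattenᵈ = map⁺ ∘′ All.map Pointwise.concat⁺

lemmaB13 : (Γ : Env) → WfEnv Γ → (∇ : TEnv)
    → (TBs : List Table) (τs : List ProdTy)
    → Pointwise (λ TB τ → Γ , ∇ ⊢T TB ▷ τ) TBs τs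
    → (Ls : List LocTable)
    → All (λ { (l , I , R) → Γ , ∇ ⊢C I , R }) Ls
    → ∀ R → ⊗R TBs Ls R
    → ∀ t′ → t′ ∈ R → [] ⊢t t′ ▷ flattenₛ τs
lemmaB13 Γ _ ∇ TBs τs TBs▷τs Ls Ls-typed _ (Rs , sels , refl) t′ t′∈R =
  lookup (All-flattenᵈ (All-cartesian (Sels-typed Ls-typed TBs▷τs sels))) t′∈R
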